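{- Let $X$ and $Y$ be finite nonempty sets and $F: X\to 2^Y$ a set-valued mapping. The following are equivalent: (i) $F$ admits a unique alldifferent selection; (ii) $F^*(x)$ is a singleton for each $x\in X$; (iii) $F$ admits a Hall partition and $F^p(x)$ is a singleton for each $x \in X$; (iv) $F$ admits a Hall partition $(W_1,\ldots,W_m)$ with $m = \sharp F(X)$.
   Context: A set-valued mapping $F: X \to 2^Y$ assigns to each $x$ a (possibly empty) subset $F(x) \subset Y$; $F(W) = \bigcup_{x\in W}F(x)$; $\sharp$ is cardinality. A selection of $F$ is $s: X\to Y$ with $s(x)\in F(x)$ for all $x$; alldifferent means injective. The alldifferent kernel is $F^*(x) = \{y\in F(x): \exists$ alldifferent selection $s$ of $F$ with $s(x)=y\}$. For $W \subset X$, $F_W: X\setminus W \to 2^Y$ is $F_W(x) = F(x) \setminus F(W)$. For set-valued $G$ on a finite set, a subset $W$ of its domain is critical for $G$ if $W\ne\emptyset$ and $\sharp G(W)=\sharp W$; non-reducible for $G$ if $W\ne\emptyset$ and no proper subset of $W$ is critical for $G$. A tuple $(W_1,\ldots,W_m)$, $m\ge1$, is a Hall partition of $F$ if the $W_i$ are nonempty, pairwise disjoint with union $X$, and with $G_i = F_{W_1\cup\cdots\cup W_{i-1}}$ ($G_1=F$): (i) $G_i(x)\neq\emptyset$ for $x \in W_i$; (ii) $W_i$ is non-reducible for $G_i$; (iii) $W_i$ is critical for $G_i$ for $i \le m-1$. Given a Hall partition, $F^p(x) = G_i(x)$ for $x\in W_i$ (this is independent of the choice of Hall partition). -}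

module Defs where

open import Data.Nat using (ℕ; suc; _<_)
open import Data.Fin using (Fin; toℕ)
open import Data.Fin.Properties using (_<?_)
open import Data.Fin.Subset using (Subset; _∈_; _∉_; _⊂_; _─_; ⋃; ∣_∣; Nonempty; Empty; _∩_; ⊥)
open import Data.Fin.Subset.Properties using (_∈?_)
open import Data.List using (List; map; filter; allFin)
open import Data.Product using (Σ; ∃; _×_; _,_)
open import Relation.Binary.PropositionalEquality using (_≡_; _≢_)
open import Relation.Nullary using (¬_)
open import Function.Definitions using (Injective)

SetMap : ℕ → ℕ → Set
SetMap n k = Fin n → Subset k

Selection : ∀ {n k} → SetMap n k → (Fin n → Fin k) → Set
Selection F s = ∀ x → s x ∈ F x

AllDiffSelection : ∀ {n k} → SetMap n k → (Fin n → Fin k) → Set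
AllDiffSelection F s = Selection F s × Injective _≡_ _≡_ s

UniqueAllDiff : ∀ {n k} → SetMap n k → Set
UniqueAllDiff F = Σ (Fin _ → Fin _) λ s → AllDiffSelection F s ×
  (∀ t → AllDiffSelection F t → ∀ x → t x ≡ s x)

Kernel : ∀ {n k} → SetMap n k → Fin n → Fin k → Set
Kernel F x y = y ∈ F x × Σ (Fin _ → Fin _) λ s → AllDiffSelection F s × s x ≡ y

IsSingleton : ∀ {A : Set} → (A → Set) → Set
IsSingleton {A} P = Σ A λ y → P y × (∀ z → P z → z ≡ y)

Img : ∀ {n k} → SetMap n k → Subset n → Subset k
Img {n} F W = ⋃ (map F (filter (_∈? W) (allFin n)))

-- F_W(x) = F(x) \ F(W)  (meaningful for x ∉ W)
Restr : ∀ {n k} → SetMap n k → Subset n → SetMap n k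
Restr F W x = F x ─ Img F W

Critical : ∀ {n k} → SetMap n k → Subset n → Set
Critical G W = Nonempty W × ∣ Img G W ∣ ≡ ∣ W ∣

NonReducible : ∀ {n k} → SetMap n k → Subset n → Set
NonReducible G W = Nonempty W × (∀ V → V ⊂ W → ¬ Critical G V)

Prefix : ∀ {m n} → (Fin m → Subset n) → Fin m → Subset n
Prefix {m} W i = ⋃ (map W (filter (_<? i) (allFin m)))

GHall : ∀ {m n k} → SetMap n k → (Fin m → Subset n) → Fin m → SetMap n k
GHall F W i = Restr F (Prefix W i)

record HallPartition {n k : ℕ} (F : SetMap n k) (m : ℕ) (W : Fin m → Subset n) : Set where
  field
    m≥1       : 0 < m
    nonempty  : ∀ i → Nonempty (W i)
    disjoint  : ∀ i j → i ≢ j → Empty (W i ∩ W j)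
    covers    : ∀ x → ∃ λ i → x ∈ W i
    values    : ∀ i x → x ∈ W i → Nonempty (GHall F W i x)
    nonreduc  : ∀ i → NonReducible (GHall F W i) (W i)
    critical  : ∀ i → suc (toℕ i) < m → Critical (GHall F W i) (W i)

{-# OPTIONS --safe #-}
-- (i) ⇔ (ii) is immediate.  If the reduced values Fᵖ(x) of a Hall partition are singletons, then
-- every block is a singleton (a point of a larger block would be a critical proper subset), the
-- values form an alldifferent selection s, and every alldifferent t agrees with s, by induction
-- along the partition: each y ∈ F(x) is s(x′) for some x′ in the block of x or an earlier one.
-- If m = ♯F(X), the sets G_i(W_i) are m nonempty disjoint subsets of F(X), so each Fᵖ(x) is a
-- singleton.  Conversely, let s be the unique alldifferent selection.  Every value of F is taken
-- by s, and the digraph x → x′ with s(x′) ∈ F(x) has no cycles but loops, since shifting s along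
-- a cycle gives another alldifferent selection.  So every nonempty set of points has a sink,
-- and removing sinks one at a time yields a Hall partition into n = ♯F(X) singletons.

module Submission where

open import Defs
open import Data.Nat as ℕ using (ℕ; zero; suc; _≤_; _<_; s≤s)
import Data.Nat.Properties as ℕ
open import Data.Nat.GeneralisedArithmetic using (fold; fold-+)
open import Data.Fin as Fin using (Fin; toℕ; fromℕ<)
import Data.Fin.Properties as Fin
open import Data.Fin.Subset
open import Data.Fin.Subset.Properties
open import Data.Vec using (_∷_; here; there)
open import Data.List using (List; []; _∷_; map; filter; allFin)
open import Data.List.Membership.Propositional using () renaming (_∈_ to _∈ₗ_)
open import Data.List.Membership.Propositional.Properties using (∈-filter⁺; ∈-filter⁻; ∈-allFin)
open import Data.List.Relation.Unary.Any using (here; there)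
open import Data.Product using (Σ; ∃; _×_; _,_; proj₁; proj₂)
open import Data.Sum using (inj₁; inj₂)
open import Data.Empty using (⊥-elim)
open import Function using (_∘_; case_of_)
open import Function.Bundles using (_⇔_; mk⇔)
open import Function.Definitions using (Injective)
open import Relation.Binary.PropositionalEquality
open import Relation.Nullary using (Dec; yes; no)
open import Relation.Nullary.Decidable using (_×-dec_; ¬?)
open import Relation.Binary.Definitions using (tri<; tri≈; tri>)
open import Induction.WellFounded using (Acc; acc)
import Data.Fin.Induction as Fin

∈-⋃-map⁻ : ∀ {A : Set} {k} (f : A → Subset k) (as : List A) {y} →
           y ∈ ⋃ (map f as) → ∃ λ a → a ∈ₗ as × y ∈ f a
∈-⋃-map⁻ f [] y∈ = ⊥-elim (∉⊥ y∈)
∈-⋃-map⁻ f (a ∷ as) y∈ with x∈p∪q⁻ (f a) (⋃ (map f as)) y∈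
... | inj₁ y∈fa = a , here refl , y∈fa
... | inj₂ y∈⋃ with ∈-⋃-map⁻ f as y∈⋃
...   | b , b∈ , y∈fb = b , there b∈ , y∈fb

∈-⋃-map⁺ : ∀ {A : Set} {k} (f : A → Subset k) (as : List A) {a y} →
           a ∈ₗ as → y ∈ f a → y ∈ ⋃ (map f as)
∈-⋃-map⁺ f (b ∷ as) (here refl) y∈ = x∈p∪q⁺ (inj₁ y∈)
∈-⋃-map⁺ f (b ∷ as) (there a∈) y∈ = x∈p∪q⁺ (inj₂ (∈-⋃-map⁺ f as a∈ y∈))

x∈p─q⇒x∉q : ∀ {k} {p q : Subset k} {x} → x ∈ p ─ q → x ∉ q
x∈p─q⇒x∉q {p = inside ∷ _} {outside ∷ _} here ()
x∈p─q⇒x∉q {p = _ ∷ _}      {_ ∷ _}       (there x∈) (there x∈q) = x∈p─q⇒x∉q x∈ x∈q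

∣⁅x⁆∪p∣≤1+∣p∣ : ∀ {k} (x : Fin k) (p : Subset k) → ∣ ⁅ x ⁆ ∪ p ∣ ≤ suc ∣ p ∣
∣⁅x⁆∪p∣≤1+∣p∣ Fin.zero    (inside ∷ p)  = s≤s (ℕ.m≤n⇒m≤1+n (ℕ.≤-reflexive (cong ∣_∣ (∪-identityˡ p))))
∣⁅x⁆∪p∣≤1+∣p∣ Fin.zero    (outside ∷ p) = s≤s (ℕ.≤-reflexive (cong ∣_∣ (∪-identityˡ p)))
∣⁅x⁆∪p∣≤1+∣p∣ (Fin.suc x) (inside ∷ p)  = s≤s (∣⁅x⁆∪p∣≤1+∣p∣ x p)
∣⁅x⁆∪p∣≤1+∣p∣ (Fin.suc x) (outside ∷ p) = ∣⁅x⁆∪p∣≤1+∣p∣ x p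

x∉p⇒∣⁅x⁆∪p∣≡1+∣p∣ : ∀ {k} {x : Fin k} {p : Subset k} → x ∉ p → ∣ ⁅ x ⁆ ∪ p ∣ ≡ suc ∣ p ∣
x∉p⇒∣⁅x⁆∪p∣≡1+∣p∣ {x = Fin.zero}  {inside ∷ p}  x∉p = ⊥-elim (x∉p here)
x∉p⇒∣⁅x⁆∪p∣≡1+∣p∣ {x = Fin.zero}  {outside ∷ p} x∉p = cong (suc ∘ ∣_∣) (∪-identityˡ p)
x∉p⇒∣⁅x⁆∪p∣≡1+∣p∣ {x = Fin.suc x} {inside ∷ p}  x∉p = cong suc (x∉p⇒∣⁅x⁆∪p∣≡1+∣p∣ (x∉p ∘ there))
x∉p⇒∣⁅x⁆∪p∣≡1+∣p∣ {x = Fin.suc x} {outside ∷ p} x∉p = x∉p⇒∣⁅x⁆∪p∣≡1+∣p∣ (x∉p ∘ there)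

image : ∀ {a k} → (Fin a → Fin k) → Subset k
image {zero}  f = ⊥
image {suc a} f = ⁅ f Fin.zero ⁆ ∪ image (f ∘ Fin.suc)

∈-image⁺ : ∀ {a k} (f : Fin a → Fin k) i → f i ∈ image f
∈-image⁺ f Fin.zero    = x∈p∪q⁺ (inj₁ (x∈⁅x⁆ (f Fin.zero)))
∈-image⁺ f (Fin.suc i) = x∈p∪q⁺ (inj₂ (∈-image⁺ (f ∘ Fin.suc) i))

∈-image⁻ : ∀ {a k} (f : Fin a → Fin k) {y} → y ∈ image f → ∃ λ i → f i ≡ y
∈-image⁻ {zero}  f y∈ = ⊥-elim (∉⊥ y∈)
∈-image⁻ {suc a} f y∈ with x∈p∪q⁻ ⁅ f Fin.zero ⁆ (image (f ∘ Fin.suc)) y∈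
... | inj₁ y∈⁅f0⁆ = Fin.zero , sym (x∈⁅y⁆⇒x≡y _ y∈⁅f0⁆)
... | inj₂ y∈img with ∈-image⁻ (f ∘ Fin.suc) y∈img
...   | i , fi≡y = Fin.suc i , fi≡y

∣image∣≡ : ∀ {a k} (f : Fin a → Fin k) → Injective _≡_ _≡_ f → ∣ image f ∣ ≡ a
∣image∣≡ {zero}  {k} f f-inj = ∣⊥∣≡0 k
∣image∣≡ {suc a} f f-inj = begin
  ∣ ⁅ f Fin.zero ⁆ ∪ image (f ∘ Fin.suc) ∣ ≡⟨ x∉p⇒∣⁅x⁆∪p∣≡1+∣p∣ f0∉ ⟩
  suc ∣ image (f ∘ Fin.suc) ∣            ≡⟨ cong suc (∣image∣≡ (f ∘ Fin.suc) (Fin.suc-injective ∘ f-inj)) ⟩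
  suc a                                  ∎
  where
  open ≡-Reasoning
  f0∉ : f Fin.zero ∉ image (f ∘ Fin.suc)
  f0∉ f0∈ with ∈-image⁻ (f ∘ Fin.suc) f0∈
  ... | i , fi≡f0 with () ← f-inj fi≡f0

injective⇒≤∣∣ : ∀ {a k} (f : Fin a → Fin k) (S : Subset k) →
                Injective _≡_ _≡_ f → (∀ i → f i ∈ S) → a ≤ ∣ S ∣
injective⇒≤∣∣ f S f-inj f∈S = subst (_≤ ∣ S ∣) (∣image∣≡ f f-inj) (p⊆q⇒∣p∣≤∣q∣ image⊆S)
  where
  image⊆S : image f ⊆ S
  image⊆S y∈ with i , refl ← ∈-image⁻ f y∈ = f∈S i

injective⇒surjective : ∀ {n} (f : Fin n → Fin n) → Injective _≡_ _≡_ f → ∀ x → ∃ λ i → f i ≡ x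
injective⇒surjective {n} f f-inj x =
  ∈-image⁻ f (subst (x ∈_) (sym (∣p∣≡n⇒p≡⊤ (∣image∣≡ f f-inj))) ∈⊤)

module _ {n k} (F : SetMap n k) (V : Subset n) where

  ∈-Img⁻ : ∀ {y} → y ∈ Img F V → ∃ λ x → x ∈ V × y ∈ F x
  ∈-Img⁻ y∈ with ∈-⋃-map⁻ F (filter (_∈? V) (allFin n)) y∈
  ... | x , x∈ , y∈Fx = x , proj₂ (∈-filter⁻ (_∈? V) {xs = allFin n} x∈) , y∈Fx

  ∈-Img⁺ : ∀ {x y} → x ∈ V → y ∈ F x → y ∈ Img F V
  ∈-Img⁺ {x} x∈V = ∈-⋃-map⁺ F (filter (_∈? V) (allFin n)) (∈-filter⁺ (_∈? V) (∈-allFin x) x∈V)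

  ∈-Restr⁻ : ∀ {x y} → y ∈ Restr F V x → y ∈ F x × y ∉ Img F V
  ∈-Restr⁻ {x} y∈ = p─q⊆p (F x) (Img F V) y∈ , x∈p─q⇒x∉q y∈

  ∈-Restr⁺ : ∀ {x y} → y ∈ F x → y ∉ Img F V → y ∈ Restr F V x
  ∈-Restr⁺ = x∈p∧x∉q⇒x∈p─q

module _ {m n} (W : Fin m → Subset n) (i : Fin m) where

  ∈-Prefix⁻ : ∀ {x} → x ∈ Prefix W i → ∃ λ j → j Fin.< i × x ∈ W j
  ∈-Prefix⁻ x∈ with ∈-⋃-map⁻ W (filter (Fin._<? i) (allFin m)) x∈
  ... | j , j∈ , x∈Wj = j , proj₂ (∈-filter⁻ (Fin._<? i) {xs = allFin m} j∈) , x∈Wj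

  ∈-Prefix⁺ : ∀ {j x} → j Fin.< i → x ∈ W j → x ∈ Prefix W i
  ∈-Prefix⁺ {j} j<i = ∈-⋃-map⁺ W (filter (Fin._<? i) (allFin m)) (∈-filter⁺ (Fin._<? i) (∈-allFin j) j<i)

module _ {n k} {F : SetMap n k} where

  uniqueAllDiff⇒kernel-singleton : UniqueAllDiff F → ∀ x → IsSingleton (Kernel F x)
  uniqueAllDiff⇒kernel-singleton (s , s-allDiff , s-unique) x =
    s x , (proj₁ s-allDiff x , s , s-allDiff , refl) ,
    λ { y (_ , t , t-allDiff , refl) → s-unique t t-allDiff x }

  kernel-singleton⇒uniqueAllDiff : 0 < n → (∀ x → IsSingleton (Kernel F x)) → UniqueAllDiff F
  kernel-singleton⇒uniqueAllDiff 0<n kernel-singleton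
    with _ , (_ , s , s-allDiff , _) , _ ← kernel-singleton (fromℕ< 0<n) =
    s , s-allDiff , λ t t-allDiff x → trans (onKernel t t-allDiff x) (sym (onKernel s s-allDiff x))
    where
    onKernel : ∀ t → AllDiffSelection F t → ∀ x → t x ≡ proj₁ (kernel-singleton x)
    onKernel t t-allDiff x = proj₂ (proj₂ (kernel-singleton x)) (t x) (proj₁ t-allDiff x , t , t-allDiff , refl)

FᵖSingleton : ∀ {n k m} → SetMap n k → (Fin m → Subset n) → Set
FᵖSingleton F W = ∀ i x → x ∈ W i → IsSingleton (λ y → y ∈ GHall F W i x)

module _ {n k} (G : SetMap n k) (x : Fin n) where

  Img-⁅⁆ : Img G ⁅ x ⁆ ≡ G x
  Img-⁅⁆ = ⊆-antisym Img⊆ (∈-Img⁺ G ⁅ x ⁆ (x∈⁅x⁆ x))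
    where
    Img⊆ : Img G ⁅ x ⁆ ⊆ G x
    Img⊆ y∈ with x′ , x′∈ , y∈Gx′ ← ∈-Img⁻ G ⁅ x ⁆ y∈ = subst (λ z → _ ∈ G z) (x∈⁅y⁆⇒x≡y x x′∈) y∈Gx′

  singleton⇒critical-⁅⁆ : IsSingleton (_∈ G x) → Critical G ⁅ x ⁆
  singleton⇒critical-⁅⁆ (a , a∈ , a-unique) = (x , x∈⁅x⁆ x) , (begin
    ∣ Img G ⁅ x ⁆ ∣ ≡⟨ cong ∣_∣ (trans Img-⁅⁆ Gx≡⁅a⁆) ⟩
    ∣ ⁅ a ⁆ ∣       ≡⟨ ∣⁅x⁆∣≡1 a ⟩
    1               ≡⟨ ∣⁅x⁆∣≡1 x ⟨
    ∣ ⁅ x ⁆ ∣       ∎)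
    where
    open ≡-Reasoning
    Gx≡⁅a⁆ : G x ≡ ⁅ a ⁆
    Gx≡⁅a⁆ = ⊆-antisym (λ {y} y∈ → subst (_∈ ⁅ a ⁆) (sym (a-unique y y∈)) (x∈⁅x⁆ a))
                       (λ {y} y∈ → subst (_∈ G x) (sym (x∈⁅y⁆⇒x≡y a y∈)) a∈)

  nonReducible-⁅⁆ : NonReducible G ⁅ x ⁆
  nonReducible-⁅⁆ = (x , x∈⁅x⁆ x) , λ { V (V⊆⁅x⁆ , z , z∈⁅x⁆ , z∉V) ((v , v∈V) , _) →
    z∉V (subst (_∈ V) (trans (x∈⁅y⁆⇒x≡y x (V⊆⁅x⁆ v∈V)) (sym (x∈⁅y⁆⇒x≡y x z∈⁅x⁆))) v∈V) }

module _ {m k} (A : Fin m → Fin k → Set) (S : Subset k)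
         (disjoint : ∀ {i j y} → A i y → A j y → i ≡ j) (inhabited : ∀ i → ∃ (A i))
         (A⊆S : ∀ {i y} → A i y → y ∈ S) (∣S∣≤m : ∣ S ∣ ≤ m) where

  -- Two values in one member and one value in each other member would be m + 1 distinct points of S.
  disjointFamily-singleton : ∀ {i y y′} → A i y → A i y′ → y ≡ y′
  disjointFamily-singleton {i} {y} {y′} a a′ with y Fin.≟ y′
  ... | yes y≡y′ = y≡y′
  ... | no y≢y′ = ⊥-elim (ℕ.<⇒≱ (injective⇒≤∣∣ g S g-injective g∈S) ∣S∣≤m)
    where
    pick : ∀ j → Σ (Fin k) λ z → A j z × z ≢ y′
    pick j with j Fin.≟ i
    ... | yes refl = y , a , y≢y′
    ... | no j≢i with z , az ← inhabited j = z , az , λ { refl → j≢i (disjoint az a′) }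

    g : Fin (suc m) → Fin k
    g Fin.zero    = y′
    g (Fin.suc j) = proj₁ (pick j)

    g-injective : Injective _≡_ _≡_ g
    g-injective {Fin.zero}  {Fin.zero}  _  = refl
    g-injective {Fin.zero}  {Fin.suc j} eq = ⊥-elim (proj₂ (proj₂ (pick j)) (sym eq))
    g-injective {Fin.suc j} {Fin.zero}  eq = ⊥-elim (proj₂ (proj₂ (pick j)) eq)
    g-injective {Fin.suc i} {Fin.suc j} eq =
      cong Fin.suc (disjoint (proj₁ (proj₂ (pick i))) (subst (A j) (sym eq) (proj₁ (proj₂ (pick j)))))

    g∈S : ∀ j → g j ∈ S
    g∈S Fin.zero    = A⊆S a′
    g∈S (Fin.suc j) = A⊆S (proj₁ (proj₂ (pick j)))

module HallPartitionProperties {n k m} {F : SetMap n k} {W : Fin m → Subset n} (H : HallPartition F m W) where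
  open HallPartition H

  block : Fin n → Fin m
  block x = proj₁ (covers x)

  ∈-block : ∀ x → x ∈ W (block x)
  ∈-block x = proj₂ (covers x)

  block-unique : ∀ {i j x} → x ∈ W i → x ∈ W j → i ≡ j
  block-unique {i} {j} x∈Wi x∈Wj with i Fin.≟ j
  ... | yes i≡j = i≡j
  ... | no i≢j = ⊥-elim (disjoint i j i≢j (_ , x∈p∩q⁺ (x∈Wi , x∈Wj)))

  GHall⊆F : ∀ {i x y} → y ∈ GHall F W i x → y ∈ F x
  GHall⊆F {i} = proj₁ ∘ ∈-Restr⁻ F (Prefix W i)

  GHall-avoids-earlier : ∀ {i j x x′ y} → j Fin.< i → x ∈ W j → y ∈ F x → y ∉ GHall F W i x′
  GHall-avoids-earlier {i} j<i x∈Wj y∈Fx y∈G =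
    proj₂ (∈-Restr⁻ F (Prefix W i) y∈G) (∈-Img⁺ F (Prefix W i) (∈-Prefix⁺ W i j<i x∈Wj) y∈Fx)

  cardinality⇒FᵖSingleton : m ≡ ∣ Img F ⊤ ∣ → FᵖSingleton F W
  cardinality⇒FᵖSingleton m≡∣FX∣ i x x∈Wi with y , y∈ ← values i x x∈Wi =
    y , y∈ , λ z z∈ → disjointFamily-singleton Value (Img F ⊤) Value-disjoint Value-inhabited
                        (λ (x , _ , y∈) → ∈-Img⁺ F ⊤ ∈⊤ (GHall⊆F y∈)) (ℕ.≤-reflexive (sym m≡∣FX∣))
                        (x , x∈Wi , z∈) (x , x∈Wi , y∈)
    where
    Value : Fin m → Fin k → Set
    Value j y = ∃ λ x → x ∈ W j × y ∈ GHall F W j x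

    Value-disjoint : ∀ {i j y} → Value i y → Value j y → i ≡ j
    Value-disjoint {i} {j} (x , x∈Wi , y∈Gi) (x′ , x′∈Wj , y∈Gj) with Fin.<-cmp i j
    ... | tri< i<j _ _ = ⊥-elim (GHall-avoids-earlier i<j x∈Wi (GHall⊆F y∈Gi) y∈Gj)
    ... | tri≈ _ i≡j _ = i≡j
    ... | tri> _ _ j<i = ⊥-elim (GHall-avoids-earlier j<i x′∈Wj (GHall⊆F y∈Gj) y∈Gi)

    Value-inhabited : ∀ j → ∃ (Value j)
    Value-inhabited j with x , x∈Wj ← nonempty j with y , y∈ ← values j x x∈Wj = y , x , x∈Wj , y∈

  module _ (Fᵖ-singleton : FᵖSingleton F W) where

    block-singleton : ∀ {i x x′} → x ∈ W i → x′ ∈ W i → x ≡ x′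
    block-singleton {i} {x} {x′} x∈Wi x′∈Wi with x Fin.≟ x′
    ... | yes x≡x′ = x≡x′
    ... | no x≢x′ = ⊥-elim (proj₂ (nonreduc i) ⁅ x ⁆ ⁅x⁆⊂Wi
                      (singleton⇒critical-⁅⁆ (GHall F W i) x (Fᵖ-singleton i x x∈Wi)))
      where
      ⁅x⁆⊂Wi : ⁅ x ⁆ ⊂ W i
      ⁅x⁆⊂Wi = (λ z∈ → subst (_∈ W i) (sym (x∈⁅y⁆⇒x≡y x z∈)) x∈Wi) ,
               x′ , x′∈Wi , x≢x′ ∘ sym ∘ x∈⁅y⁆⇒x≡y x

    s : Fin n → Fin k
    s x = proj₁ (Fᵖ-singleton (block x) x (∈-block x))

    s∈GHall : ∀ x → s x ∈ GHall F W (block x) x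
    s∈GHall x = proj₁ (proj₂ (Fᵖ-singleton (block x) x (∈-block x)))

    GHall-only-s : ∀ x {y} → y ∈ GHall F W (block x) x → y ≡ s x
    GHall-only-s x = proj₂ (proj₂ (Fᵖ-singleton (block x) x (∈-block x))) _

    s-injective : Injective _≡_ _≡_ s
    s-injective {x} {x′} sx≡sx′ with Fin.<-cmp (block x) (block x′)
    ... | tri< b<b′ _ _ = ⊥-elim (GHall-avoids-earlier b<b′ (∈-block x)
                                    (subst (_∈ F x) sx≡sx′ (GHall⊆F (s∈GHall x))) (s∈GHall x′))
    ... | tri≈ _ b≡b′ _ = block-singleton (∈-block x) (subst (λ i → x′ ∈ W i) (sym b≡b′) (∈-block x′))
    ... | tri> _ _ b′<b = ⊥-elim (GHall-avoids-earlier b′<b (∈-block x′)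
                                    (subst (_∈ F x′) (sym sx≡sx′) (GHall⊆F (s∈GHall x′))) (s∈GHall x))

    selected-no-later : ∀ x {y} → y ∈ F x → ∃ λ x′ → block x′ Fin.≤ block x × s x′ ≡ y
    selected-no-later x = go x (Fin.<-wellFounded (block x))
      where
      go : ∀ x → Acc Fin._<_ (block x) → ∀ {y} → y ∈ F x → ∃ λ x′ → block x′ Fin.≤ block x × s x′ ≡ y
      go x (acc rs) {y} y∈Fx with y ∈? Img F (Prefix W (block x))
      ... | no y∉ = x , ℕ.≤-refl , sym (GHall-only-s x (∈-Restr⁺ F _ y∈Fx y∉))
      ... | yes y∈ with x″ , x″∈ , y∈Fx″ ← ∈-Img⁻ F _ y∈
                   with j , j<b , x″∈Wj ← ∈-Prefix⁻ W (block x) x″∈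
                   with b″<b ← subst (Fin._< block x) (block-unique x″∈Wj (∈-block x″)) j<b
                   with x′ , b′≤b″ , sx′≡y ← go x″ (rs b″<b) y∈Fx″ =
        x′ , ℕ.≤-trans b′≤b″ (ℕ.<⇒≤ b″<b) , sx′≡y

    allDiff-agrees-with-s : ∀ t → AllDiffSelection F t → ∀ x → t x ≡ s x
    allDiff-agrees-with-s t (t∈F , t-injective) x = go x (Fin.<-wellFounded (block x))
      where
      go : ∀ x → Acc Fin._<_ (block x) → t x ≡ s x
      go x (acc rs) with x′ , b′≤b , sx′≡tx ← selected-no-later x (t∈F x) with ℕ.m≤n⇒m<n∨m≡n b′≤b
      ... | inj₁ b′<b = ⊥-elim (ℕ.<-irrefl (cong (toℕ ∘ block) x′≡x) b′<b)
        where
        x′≡x : x′ ≡ x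
        x′≡x = t-injective (trans (go x′ (rs b′<b)) sx′≡tx)
      ... | inj₂ b′≡b = trans (sym sx′≡tx) (cong s (block-singleton (∈-block x′) x∈Wb′))
        where
        x∈Wb′ : x ∈ W (block x′)
        x∈Wb′ = subst (λ i → x ∈ W i) (sym (Fin.toℕ-injective b′≡b)) (∈-block x)

    FᵖSingleton⇒uniqueAllDiff : UniqueAllDiff F
    FᵖSingleton⇒uniqueAllDiff = s , ((GHall⊆F ∘ s∈GHall) , s-injective) , allDiff-agrees-with-s

module Orbit {n} (f : Fin n → Fin n) where

  iter : ℕ → Fin n → Fin n
  iter i x = fold x f i

  iter-f : ∀ i x → iter i (f x) ≡ f (iter i x)
  iter-f zero    x = refl
  iter-f (suc i) x = cong f (iter-f i x)

  iter-*-fixed : ∀ c p {x} → iter p x ≡ x → iter (c ℕ.* p) x ≡ x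
  iter-*-fixed zero    p     eq = refl
  iter-*-fixed (suc c) p {x} eq = trans (fold-+ x f p) (trans (cong (iter p) (iter-*-fixed c p eq)) eq)

  -- A period is encoded as suc p with p : Fin n, which bounds it and makes Periodic decidable.
  Periodic : Fin n → Set
  Periodic x = ∃ λ (p : Fin n) → iter (suc (toℕ p)) x ≡ x

  periodic? : ∀ x → Dec (Periodic x)
  periodic? x = Fin.any? λ p → iter (suc (toℕ p)) x Fin.≟ x

  periodic-f : ∀ {x} → Periodic x → Periodic (f x)
  periodic-f {x} (p , eq) = p , trans (cong f (iter-f (toℕ p) x)) (cong f eq)

  -- f⁻¹ on a periodic point is a power of f; use a common multiple of both periods.
  periodic-injective : ∀ {x y} → Periodic x → Periodic y → f x ≡ f y → x ≡ y
  periodic-injective {x} {y} (p , x-period) (q , y-period) fx≡fy = begin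
    x                ≡⟨ iter-*-fixed (suc (toℕ q)) (suc (toℕ p)) x-period ⟨
    iter (suc r) x   ≡⟨ iter-f r x ⟨
    iter r (f x)     ≡⟨ cong (iter r) fx≡fy ⟩
    iter r (f y)     ≡⟨ iter-f r y ⟩
    iter (suc r) y   ≡⟨ cong (λ e → iter e y) (ℕ.*-comm (suc (toℕ q)) (suc (toℕ p))) ⟩
    iter (suc (toℕ p) ℕ.* suc (toℕ q)) y ≡⟨ iter-*-fixed (suc (toℕ p)) (suc (toℕ q)) y-period ⟩
    y                ∎
    where
    open ≡-Reasoning
    r = toℕ p ℕ.+ toℕ q ℕ.* suc (toℕ p)

  orbit-periodic : ∀ x → ∃ λ i → Periodic (iter i x)
  orbit-periodic x
    with a , b , a<b , xa≡xb ← Fin.pigeonhole (ℕ.n<1+n n) (λ (j : Fin (suc n)) → iter (toℕ j) x) =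
    toℕ a , fromℕ< d<n , (begin
      iter (suc (toℕ (fromℕ< d<n))) (iter (toℕ a) x) ≡⟨ cong (λ e → iter (suc e) _) (Fin.toℕ-fromℕ< d<n) ⟩
      iter (suc d) (iter (toℕ a) x)                  ≡⟨ fold-+ x f (suc d) ⟨
      iter (suc d ℕ.+ toℕ a) x                       ≡⟨ cong (λ e → iter e x) 1+d+a≡b ⟩
      iter (toℕ b) x                                 ≡⟨ xa≡xb ⟨
      iter (toℕ a) x                                 ∎)
    where
    open ≡-Reasoning
    d = toℕ b ℕ.∸ suc (toℕ a)
    1+d+a≡b : suc d ℕ.+ toℕ a ≡ toℕ b
    1+d+a≡b = trans (cong suc (ℕ.+-comm d (toℕ a))) (ℕ.m+[n∸m]≡n a<b)
    d<n : d < n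
    d<n = ℕ.m+n≤o⇒m≤o (suc d) (subst (_≤ n) (sym 1+d+a≡b) (ℕ.≤-pred (Fin.toℕ<n b)))

-- x₀ is a junk value, returned only once every point has been used.
module Greedy {n} (x₀ : Fin n) (Next : Subset n → Fin n → Set)
              (next : ∀ used → Nonempty (∁ used) → Σ (Fin n) (Next used))
              (Next⇒∉ : ∀ {used x} → Next used x → x ∉ used) where

  pickAfter : Subset n → Fin n
  pickAfter used with nonempty? (∁ used)
  ... | yes unused = proj₁ (next used unused)
  ... | no _       = x₀

  pickAfter-Next : ∀ used → Nonempty (∁ used) → Next used (pickAfter used)
  pickAfter-Next used unused with nonempty? (∁ used)
  ... | yes unused′ = proj₂ (next used unused′)
  ... | no ¬unused  = ⊥-elim (¬unused unused)

  used : ℕ → Subset n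
  used zero    = ⊥
  used (suc j) = ⁅ pickAfter (used j) ⁆ ∪ used j

  pick : ℕ → Fin n
  pick j = pickAfter (used j)

  ∈-used⁻ : ∀ j {x} → x ∈ used j → ∃ λ a → a < j × pick a ≡ x
  ∈-used⁻ zero    x∈ = ⊥-elim (∉⊥ x∈)
  ∈-used⁻ (suc j) x∈ with x∈p∪q⁻ ⁅ pick j ⁆ (used j) x∈
  ... | inj₁ x∈⁅pj⁆ = j , ℕ.n<1+n j , sym (x∈⁅y⁆⇒x≡y (pick j) x∈⁅pj⁆)
  ... | inj₂ x∈used with a , a<j , pa≡x ← ∈-used⁻ j x∈used = a , ℕ.m≤n⇒m≤1+n a<j , pa≡x

  ∈-used⁺ : ∀ {a} j → a < j → pick a ∈ used j
  ∈-used⁺ {a} (suc j) a<1+j with ℕ.m≤n⇒m<n∨m≡n (ℕ.≤-pred a<1+j)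
  ... | inj₁ a<j  = x∈p∪q⁺ (inj₂ (∈-used⁺ j a<j))
  ... | inj₂ refl = x∈p∪q⁺ (inj₁ (x∈⁅x⁆ (pick a)))

  ∣used∣≤ : ∀ j → ∣ used j ∣ ≤ j
  ∣used∣≤ zero    = ℕ.≤-reflexive (∣⊥∣≡0 n)
  ∣used∣≤ (suc j) = ℕ.≤-trans (∣⁅x⁆∪p∣≤1+∣p∣ (pick j) (used j)) (s≤s (∣used∣≤ j))

  unused-nonempty : ∀ j → j < n → Nonempty (∁ (used j))
  unused-nonempty j j<n with nonempty? (∁ (used j))
  ... | yes unused = unused
  ... | no ¬unused = ⊥-elim (ℕ.<⇒≱ j<n (begin
    n             ≡⟨ ∣⊤∣≡n n ⟨
    ∣ ⊤ {n} ∣     ≤⟨ p⊆q⇒∣p∣≤∣q∣ {p = ⊤} (λ {x} _ → x∉∁p⇒x∈p (λ x∈∁ → ¬unused (x , x∈∁))) ⟩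
    ∣ used j ∣    ≤⟨ ∣used∣≤ j ⟩
    j             ∎))
    where open ℕ.≤-Reasoning

  pick-Next : ∀ j → j < n → Next (used j) (pick j)
  pick-Next j j<n = pickAfter-Next (used j) (unused-nonempty j j<n)

  pick-injective : ∀ {a b} → a < n → b < n → pick a ≡ pick b → a ≡ b
  pick-injective {a} {b} a<n b<n pa≡pb with ℕ.<-cmp a b
  ... | tri< a<b _ _ = ⊥-elim (Next⇒∉ (pick-Next b b<n) (subst (_∈ used b) pa≡pb (∈-used⁺ b a<b)))
  ... | tri≈ _ a≡b _ = a≡b
  ... | tri> _ _ b<a = ⊥-elim (Next⇒∉ (pick-Next a a<n) (subst (_∈ used a) (sym pa≡pb) (∈-used⁺ a b<a)))

  σ : Fin n → Fin n
  σ i = pick (toℕ i)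

  σ-injective : Injective _≡_ _≡_ σ
  σ-injective {i} {j} = Fin.toℕ-injective ∘ pick-injective (Fin.toℕ<n i) (Fin.toℕ<n j)

  Prefix-σ : ∀ i → Prefix (⁅_⁆ ∘ σ) i ≡ used (toℕ i)
  Prefix-σ i = ⊆-antisym Prefix⊆used used⊆Prefix
    where
    Prefix⊆used : Prefix (⁅_⁆ ∘ σ) i ⊆ used (toℕ i)
    Prefix⊆used x∈ with j , j<i , x∈⁅σj⁆ ← ∈-Prefix⁻ (⁅_⁆ ∘ σ) i x∈ =
      subst (_∈ used (toℕ i)) (sym (x∈⁅y⁆⇒x≡y (σ j) x∈⁅σj⁆)) (∈-used⁺ (toℕ i) j<i)
    used⊆Prefix : used (toℕ i) ⊆ Prefix (⁅_⁆ ∘ σ) i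
    used⊆Prefix x∈ with a , a<i , refl ← ∈-used⁻ (toℕ i) x∈ =
      ∈-Prefix⁺ (⁅_⁆ ∘ σ) i (subst (_< toℕ i) (sym toℕj≡a) a<i)
                (subst (λ b → pick a ∈ ⁅ pick b ⁆) (sym toℕj≡a) (x∈⁅x⁆ (pick a)))
      where
      a<n = ℕ.<-trans a<i (Fin.toℕ<n i)
      toℕj≡a = Fin.toℕ-fromℕ< a<n

  σ-Next : ∀ i → Next (Prefix (⁅_⁆ ∘ σ) i) (σ i)
  σ-Next i = subst (λ used → Next used (σ i)) (sym (Prefix-σ i)) (pick-Next (toℕ i) (Fin.toℕ<n i))

module _ {n k} (F : SetMap n k) (σ : Fin n → Fin n) (σ-injective : Injective _≡_ _≡_ σ)
         (σ-Fᵖ : ∀ i → IsSingleton (λ y → y ∈ GHall F (⁅_⁆ ∘ σ) i (σ i))) where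

  singletons-FᵖSingleton : FᵖSingleton F (⁅_⁆ ∘ σ)
  singletons-FᵖSingleton i x x∈⁅σi⁆ rewrite x∈⁅y⁆⇒x≡y (σ i) x∈⁅σi⁆ = σ-Fᵖ i

  singletons-hallPartition : 0 < n → HallPartition F n (⁅_⁆ ∘ σ)
  singletons-hallPartition 0<n = record
    { m≥1      = 0<n
    ; nonempty = λ i → σ i , x∈⁅x⁆ (σ i)
    ; disjoint = λ { i j i≢j (x , x∈) → let x∈⁅σi⁆ , x∈⁅σj⁆ = x∈p∩q⁻ _ _ x∈ in
                   i≢j (σ-injective (trans (sym (x∈⁅y⁆⇒x≡y (σ i) x∈⁅σi⁆)) (x∈⁅y⁆⇒x≡y (σ j) x∈⁅σj⁆))) }
    ; covers   = λ x → let i , σi≡x = injective⇒surjective σ σ-injective x in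
                   i , subst (_∈ ⁅ σ i ⁆) σi≡x (x∈⁅x⁆ (σ i))
    ; values   = λ i x x∈ → let y , y∈ , _ = singletons-FᵖSingleton i x x∈ in y , y∈
    ; nonreduc = λ i → nonReducible-⁅⁆ (GHall F (⁅_⁆ ∘ σ) i) (σ i)
    ; critical = λ i _ → singleton⇒critical-⁅⁆ (GHall F (⁅_⁆ ∘ σ) i) (σ i) (σ-Fᵖ i)
    }

module UniqueAllDiffProperties {n k} {F : SetMap n k} (s : Fin n → Fin k) (s-allDiff : AllDiffSelection F s)
                               (s-unique : ∀ t → AllDiffSelection F t → ∀ x → t x ≡ s x) where

  s∈F : ∀ x → s x ∈ F x
  s∈F = proj₁ s-allDiff

  s-injective : Injective _≡_ _≡_ s
  s-injective = proj₂ s-allDiff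

  -- Otherwise redirecting s at x to y would give a second alldifferent selection.
  value-selected : ∀ {x y} → y ∈ F x → ∃ λ x′ → s x′ ≡ y
  value-selected {x} {y} y∈Fx with Fin.any? (λ x′ → s x′ Fin.≟ y)
  ... | yes selected = selected
  ... | no ¬selected = ⊥-elim (¬selected (x , trans (sym (s-unique t (t∈F , t-injective) x)) tx≡y))
    where
    t : Fin n → Fin k
    t z with z Fin.≟ x
    ... | yes _ = y
    ... | no _  = s z

    tx≡y : t x ≡ y
    tx≡y with x Fin.≟ x
    ... | yes _   = refl
    ... | no x≢x = ⊥-elim (x≢x refl)

    t∈F : ∀ z → t z ∈ F z
    t∈F z with z Fin.≟ x
    ... | yes refl = y∈Fx
    ... | no _     = s∈F z

    t-injective : Injective _≡_ _≡_ t
    t-injective {z} {z′} tz≡tz′ with z Fin.≟ x | z′ Fin.≟ x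
    ... | yes z≡x | yes z′≡x = trans z≡x (sym z′≡x)
    ... | yes _   | no _     = ⊥-elim (¬selected (z′ , sym tz≡tz′))
    ... | no _    | yes _    = ⊥-elim (¬selected (z , tz≡tz′))
    ... | no _    | no _     = s-injective tz≡tz′

  -- Shifting s along the cycles of f gives another alldifferent selection, so those cycles are loops.
  periodic⇒fixed : (f : Fin n → Fin n) → (∀ x → s (f x) ∈ F x) → ∀ {z} → Orbit.Periodic f z → f z ≡ z
  periodic⇒fixed f sf∈F {z} z-periodic =
    s-injective (trans (sym (t-periodic z-periodic)) (s-unique t (t∈F , t-injective) z))
    where
    open Orbit f

    t : Fin n → Fin k
    t z with periodic? z
    ... | yes _ = s (f z)
    ... | no _  = s z

    t-periodic : ∀ {z} → Periodic z → t z ≡ s (f z)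
    t-periodic {z} z-periodic with periodic? z
    ... | yes _           = refl
    ... | no ¬z-periodic = ⊥-elim (¬z-periodic z-periodic)

    t∈F : ∀ z → t z ∈ F z
    t∈F z with periodic? z
    ... | yes _ = sf∈F z
    ... | no _  = s∈F z

    t-injective : Injective _≡_ _≡_ t
    t-injective {z} {z′} tz≡tz′ with periodic? z | periodic? z′
    ... | yes p | yes p′ = periodic-injective p p′ (s-injective tz≡tz′)
    ... | yes p | no ¬p′ = ⊥-elim (¬p′ (subst Periodic (s-injective tz≡tz′) (periodic-f p)))
    ... | no ¬p | yes p′ = ⊥-elim (¬p (subst Periodic (sym (s-injective tz≡tz′)) (periodic-f p′)))
    ... | no _  | no _   = s-injective tz≡tz′

  Sink : Subset n → Fin n → Set
  Sink used x = x ∉ used × (∀ {x′} → x′ ∉ used → s x′ ∈ F x → x′ ≡ x)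

  module _ (used : Subset n) where

    Rival : Fin n → Fin n → Set
    Rival x x′ = x′ ∉ used × x′ ≢ x × s x′ ∈ F x

    rival? : ∀ x → Dec (∃ (Rival x))
    rival? x = Fin.any? λ x′ → ¬? (x′ ∈? used) ×-dec ¬? (x′ Fin.≟ x) ×-dec (s x′ ∈? F x)

    step : Fin n → Fin n
    step x with rival? x
    ... | yes (x′ , _) = x′
    ... | no _         = x

    s-step∈F : ∀ x → s (step x) ∈ F x
    s-step∈F x with rival? x
    ... | yes (_ , _ , _ , sx′∈Fx) = sx′∈Fx
    ... | no _                     = s∈F x

    step-unused : ∀ {x} → x ∉ used → step x ∉ used
    step-unused {x} x∉ with rival? x
    ... | yes (_ , x′∉ , _) = x′∉
    ... | no _              = x∉

    step-moves : ∀ {x} → ∃ (Rival x) → step x ≢ x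
    step-moves {x} rival with rival? x
    ... | yes (_ , _ , x′≢x , _) = x′≢x
    ... | no ¬rival              = ⊥-elim (¬rival rival)

    step-fixed⇒sink : ∀ {x} → x ∉ used → step x ≡ x → Sink used x
    step-fixed⇒sink {x} x∉ step-x≡x = x∉ , λ {x′} x′∉ sx′∈Fx → case x′ Fin.≟ x of λ
      { (yes x′≡x) → x′≡x
      ; (no x′≢x)  → ⊥-elim (step-moves (x′ , x′∉ , x′≢x , sx′∈Fx) step-x≡x) }

    sink : Nonempty (∁ used) → Σ (Fin n) (Sink used)
    sink (x₀ , x₀∈∁) with i , z-periodic ← Orbit.orbit-periodic step x₀ =
      Orbit.iter step i x₀ , step-fixed⇒sink (iter-unused i) (periodic⇒fixed step s-step∈F z-periodic)
      where
      iter-unused : ∀ i → Orbit.iter step i x₀ ∉ used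
      iter-unused zero    = x∈∁p⇒x∉p x₀∈∁
      iter-unused (suc i) = step-unused (iter-unused i)

  module SinkEnumeration (x₀ : Fin n) where
    open Greedy x₀ Sink sink proj₁ public using (σ; σ-injective)
    open Greedy x₀ Sink sink proj₁ using (σ-Next)

    σ∈Prefix⇒< : ∀ {i j} → σ i ∈ Prefix (⁅_⁆ ∘ σ) j → i Fin.< j
    σ∈Prefix⇒< {i} {j} σi∈ with j′ , j′<j , σi∈⁅σj′⁆ ← ∈-Prefix⁻ (⁅_⁆ ∘ σ) j σi∈ =
      subst (Fin._< j) (sym (σ-injective (x∈⁅y⁆⇒x≡y (σ j′) σi∈⁅σj′⁆))) j′<j

    s∘σ∉Img-Prefix : ∀ i → s (σ i) ∉ Img F (Prefix (⁅_⁆ ∘ σ) i)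
    s∘σ∉Img-Prefix i sσi∈ with x , x∈ , sσi∈Fx ← ∈-Img⁻ F _ sσi∈
                          with j , j<i , x∈⁅σj⁆ ← ∈-Prefix⁻ (⁅_⁆ ∘ σ) i x∈ =
      ℕ.<-irrefl (cong toℕ (sym i≡j)) j<i
      where
      σi∉Prefix : σ i ∉ Prefix (⁅_⁆ ∘ σ) j
      σi∉Prefix σi∈ = ℕ.<-asym (σ∈Prefix⇒< σi∈) j<i
      i≡j : i ≡ j
      i≡j = σ-injective (proj₂ (σ-Next j) σi∉Prefix
                                (subst (λ z → s (σ i) ∈ F z) (x∈⁅y⁆⇒x≡y (σ j) x∈⁅σj⁆) sσi∈Fx))

    σ-Fᵖ : ∀ i → IsSingleton (λ y → y ∈ GHall F (⁅_⁆ ∘ σ) i (σ i))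
    σ-Fᵖ i = s (σ i) , ∈-Restr⁺ F _ (s∈F (σ i)) (s∘σ∉Img-Prefix i) , only-s∘σ
      where
      only-s∘σ : ∀ y → y ∈ GHall F (⁅_⁆ ∘ σ) i (σ i) → y ≡ s (σ i)
      only-s∘σ y y∈ with y∈F , y∉Img ← ∈-Restr⁻ F _ y∈ with x′ , refl ← value-selected y∈F =
        cong s (proj₂ (σ-Next i) (λ x′∈ → y∉Img (∈-Img⁺ F _ x′∈ (s∈F x′))) y∈F)

  image-s≡FX : image s ≡ Img F ⊤
  image-s≡FX = ⊆-antisym
    (λ y∈ → let x , sx≡y = ∈-image⁻ s y∈ in ∈-Img⁺ F ⊤ ∈⊤ (subst (_∈ F x) sx≡y (s∈F x)))
    (λ y∈ → let _ , _ , y∈Fx = ∈-Img⁻ F ⊤ y∈ ; x′ , sx′≡y = value-selected y∈Fx in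
            subst (_∈ image s) sx′≡y (∈-image⁺ s x′))

  n≡∣FX∣ : n ≡ ∣ Img F ⊤ ∣
  n≡∣FX∣ = trans (sym (∣image∣≡ s s-injective)) (cong ∣_∣ image-s≡FX)

module _ {n k} {F : SetMap n k} where

  uniqueAllDiff⇒hallPartition : 0 < n → UniqueAllDiff F →
                                Σ (Fin n → Subset n) λ W → HallPartition F n W × FᵖSingleton F W
  uniqueAllDiff⇒hallPartition 0<n (s , s-allDiff , s-unique) =
    ⁅_⁆ ∘ σ , singletons-hallPartition F σ σ-injective σ-Fᵖ 0<n ,
    singletons-FᵖSingleton F σ σ-injective σ-Fᵖ
    where
    open UniqueAllDiffProperties s s-allDiff s-unique
    open SinkEnumeration (fromℕ< 0<n)

  uniqueAllDiff⇒n≡∣FX∣ : UniqueAllDiff F → n ≡ ∣ Img F ⊤ ∣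
  uniqueAllDiff⇒n≡∣FX∣ (s , s-allDiff , s-unique) = UniqueAllDiffProperties.n≡∣FX∣ s s-allDiff s-unique

open HallPartitionProperties using (FᵖSingleton⇒uniqueAllDiff; cardinality⇒FᵖSingleton)

theorem7p1 : (n k : ℕ) → 0 < n → 0 < k → (F : SetMap n k) →
    (UniqueAllDiff F ⇔ (∀ x → IsSingleton (Kernel F x)))
    × (UniqueAllDiff F ⇔ (Σ ℕ λ m → Σ (Fin m → Subset n) λ W → HallPartition F m W
                            × (∀ i x → x ∈ W i → IsSingleton (λ y → y ∈ GHall F W i x))))
    × (UniqueAllDiff F ⇔ (Σ ℕ λ m → Σ (Fin m → Subset n) λ W → HallPartition F m W
                            × m ≡ ∣ Img F ⊤ ∣))
theorem7p1 n k 0<n _ F =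
  mk⇔ uniqueAllDiff⇒kernel-singleton (kernel-singleton⇒uniqueAllDiff 0<n) ,
  mk⇔ (λ U → let W , H , Fᵖ-singleton = uniqueAllDiff⇒hallPartition 0<n U in n , W , H , Fᵖ-singleton)
      (λ (_ , _ , H , Fᵖ-singleton) → FᵖSingleton⇒uniqueAllDiff H Fᵖ-singleton) ,
  mk⇔ (λ U → let W , H , _ = uniqueAllDiff⇒hallPartition 0<n U in n , W , H , uniqueAllDiff⇒n≡∣FX∣ U)
      (λ (_ , _ , H , m≡∣FX∣) → FᵖSingleton⇒uniqueAllDiff H (cardinality⇒FᵖSingleton H m≡∣FX∣))
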